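{- Let $X=\{1,\ldots,n\}$ with $n\ge3$, and let $\delta$ be a dissimilarity map on $X$. The split system $\mathcal{T}$ recorded by the neighbor-net algorithm on input $\delta$ is pairwise compatible and is in bijection with a binary tree $T$ (the tree whose clusters are the successively merged blocks $C_{r^*}\cup C_{s^*}$). Moreover, suppose that in every adjustment step the weighting is updated by a tree weighting with parameter $\alpha\in[0,1]$ (the parameter may depend on the step). Then $T$ is the neighbor-joining tree for $\delta$ obtained using, at every step, the agglomeration parameter equal to the tree weighting parameter $\alpha$ of that step.
   Context: Dissimilarity map: a function $\delta:X\times X\to\mathbb{R}$ with $\delta(i,j)=\delta(j,i)\ge0$ and $\delta(i,i)=0$. Split: a partition $\{A,B\}$ of $X$ into two blocks. A split system is pairwise compatible if for any two distinct splits $\{A,B\},\{A',B'\}$ in it, at least one of $A\cap A'$, $A\cap B'$, $B\cap A'$, $B\cap B'$ is empty. Partial circular ordering: a partition $\mathcal{C}=\{C_1,\ldots,C_m\}$ of $X$ into blocks, each a path (a linear order). $\hat C_r$ denotes the endpoints of $C_r$: the single element if $|C_r|=1$, and the two ends otherwise. Weighting: a function $\mu:X\to\mathbb{R}_{\ge0}$ with $\sum_{i\in C_r}\mu(i)=1$ for every $r$ and $\mu(i)>0$ on $\hat C_r$. One sets $\delta(C_r,C_s)=\sum_{i\in C_r,j\in C_s}\mu(i)\mu(j)\delta(i,j)$ and $\delta(x,C_r)=\sum_{i\in C_r}\mu(i)\delta(x,i)$. Neighbor-net algorithm. Start with $\mathcal{C}$ the $n$ singletons and $\mu\equiv1$.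 While $m=|\mathcal{C}|>1$, perform the following steps. (1) Choose blocks $C_{r^*}\ne C_{s^*}$ minimizing $Q_\delta(C_r,C_s)=(m-2)\delta(C_r,C_s)-\sum_{t\ne r}\delta(C_r,C_t)-\sum_{t\ne s}\delta(C_t,C_s)$. (2) Choose $i^*\in\hat C_{r^*}$ and $j^*\in\hat C_{s^*}$ minimizing $\hat Q_\delta(i,j)=(m-4+|\hat C_{r^*}|+|\hat C_{s^*}|)\delta(i,j)-\sum_{t\ne r^*,s^*}\delta(i,C_t)-\sum_{t\ne r^*,s^*}\delta(j,C_t)-\sum_{k\in(C_{r^*}\cup C_{s^*})\setminus\{i\}}\delta(i,k)-\sum_{k\in(C_{r^*}\cup C_{s^*})\setminus\{j\}}\delta(j,k)$. (3) Join the paths by an edge $i^*j^*$, merging the two blocks. (4) Adjustment step: redefine $\mu$ on the merged block so that it is again a weighting. (5) Record the split $\{C_{r^*}\cup C_{s^*},X\setminus(C_{r^*}\cup C_{s^*})\}$ in $\mathcal{T}$. Tree weighting: in the adjustment step, the new weighting is $\mu'(i)=\alpha\mu(i)$ for $i\in C_{r^*}$ and $\mu'(i)=(1-\alpha)\mu(i)$ for $i\in C_{s^*}$, for some $0\le\alpha\le1$. Neighbor-joining with agglomeration parameters. Maintain a partition of $X$ into clusters with a dissimilarity $D$ between clusters, initially the singletons with $D=\delta$. While there is more than one cluster, with $m$ clusters do the following. Choose clusters $C_r\ne C_s$ minimizing $(m-2)D(C_r,C_s)-\sum_{t\ne r}D(C_r,C_t)-\sum_{t\ne s}D(C_t,C_s)$.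 Merge them into $C_r\cup C_s$, with $D(C_r\cup C_s,C_t)=\alpha D(C_r,C_t)+(1-\alpha)D(C_s,C_t)$, where $\alpha$ is the agglomeration parameter of that step. The neighbor-joining tree is the tree whose clusters are the successively merged clusters. -}

module Defs where

open import Level using (Level; _⊔_) renaming (suc to lsuc)
open import Algebra.Bundles using (CommutativeRing)
open import Relation.Binary.Core using (Rel)
open import Relation.Binary.Structures using (IsTotalOrder)
open import Relation.Binary.PropositionalEquality using (_≡_; _≢_)
open import Relation.Nullary using (¬_)
open import Relation.Nullary.Decidable using (¬?; _×-dec_; yes; no)
open import Data.Bool using (Bool)
import Data.Bool as Bool
open import Data.Nat as ℕ using (ℕ; zero; suc; _∸_)
open import Data.Fin using (Fin; _≟_)
open import Data.Fin.Subset as S using (Subset; ⁅_⁆; _∪_; _∩_; ∁; Empty; _⊆_)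
open import Data.List using (List; []; _∷_; _++_; map; filter; foldr; length; lookup; allFin; reverse; _∷ʳ_)
open import Data.List.Membership.Propositional using (_∈_; _∉_)
open import Data.List.Relation.Unary.All using (All)
open import Data.List.Relation.Unary.Unique.Propositional using (Unique)
open import Data.Product using (Σ; ∃; ∃-syntax; _×_; _,_; proj₁; proj₂)
open import Data.Sum using (_⊎_)
open import Data.Vec.Properties using (≡-dec)

-- A (totally) ordered commutative ring: the real numbers are the model
-- the paper has in mind; every notion below only uses ring operations
-- and the order.

record OrderedCommRing (c ℓ₁ ℓ₂ : Level) : Set (lsuc (c ⊔ ℓ₁ ⊔ ℓ₂)) where
  field
    commutativeRing : CommutativeRing c ℓ₁
  open CommutativeRing commutativeRing public
  infix 4 _≤_
  field
    _≤_          : Rel Carrier ℓ₂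
    isTotalOrder : IsTotalOrder _≈_ _≤_
    +-mono-≤     : ∀ {a b} d → a ≤ b → (a + d) ≤ (b + d)
    *-nonneg     : ∀ {a b} → 0# ≤ a → 0# ≤ b → 0# ≤ (a * b)

  infix 4 _<_
  _<_ : Rel Carrier (ℓ₁ ⊔ ℓ₂)
  a < b = (a ≤ b) × ¬ (a ≈ b)

  nat : ℕ → Carrier
  nat zero    = 0#
  nat (suc k) = 1# + nat k

  Σl : {A : Set} → List A → (A → Carrier) → Carrier
  Σl xs f = foldr (λ x acc → f x + acc) 0# xs

exceptOne : {B : Set} (cs : List B) → Fin (length cs) → List B
exceptOne cs r = map (lookup cs) (filter (λ t → ¬? (t ≟ r)) (allFin (length cs)))

exceptTwo : {B : Set} (cs : List B) → Fin (length cs) → Fin (length cs) → List B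
exceptTwo cs r s =
  map (lookup cs) (filter (λ t → ¬? (t ≟ r) ×-dec ¬? (t ≟ s)) (allFin (length cs)))

lastOf : {A : Set} → A → List A → A
lastOf x []       = x
lastOf x (y ∷ ys) = lastOf y ys

-- endpoints Ĉ of a path C (given as the list of its vertices in order)
ends : {A : Set} → List A → List A
ends []           = []
ends (x ∷ [])     = x ∷ []
ends (x ∷ y ∷ ys) = x ∷ lastOf y ys ∷ []

toSubset : {n : ℕ} → List (Fin n) → Subset n
toSubset = foldr (λ i S → ⁅ i ⁆ ∪ S) S.⊥

-- joining the path P and the path Q by an edge i j, i an end of P and
-- j an end of Q, gives the path R
Joined : {n : ℕ} → List (Fin n) → Fin n → List (Fin n) → Fin n → List (Fin n) → Set
Joined P i Q j R =
  ∃[ P' ] ∃[ Q' ] ((P' ≡ P ⊎ P' ≡ reverse P) × (Q' ≡ Q ⊎ Q' ≡ reverse Q)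
                   × (∃[ P'' ] P' ≡ P'' ∷ʳ i) × (∃[ Q'' ] Q' ≡ j ∷ Q'') × R ≡ P' ++ Q')

-- the split {U, X∖U} is encoded by U; {U,∁U} and {V,∁V} are distinct splits
DistinctSplits : {n : ℕ} → Subset n → Subset n → Set
DistinctSplits U V = (U ≢ V) × (U ≢ ∁ V)

Compatible : {n : ℕ} → Subset n → Subset n → Set
Compatible U V = Empty (U ∩ V) ⊎ Empty (U ∩ ∁ V) ⊎ Empty (∁ U ∩ V) ⊎ Empty (∁ U ∩ ∁ V)

PairwiseCompatible : {n : ℕ} → List (Subset n) → Set
PairwiseCompatible Us = ∀ U V → U ∈ Us → V ∈ Us → DistinctSplits U V → Compatible U V

singletonSets : (n : ℕ) → List (Subset n)
singletonSets n = map ⁅_⁆ (allFin n)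

-- H (listed without repetition) is the set of clusters of a rooted binary
-- tree with leaf set X = Fin n: it contains X and all singletons, all its
-- members are nonempty, any two members are nested or disjoint, and every
-- member with at least two elements is the disjoint union of two proper
-- members (its two children).
IsBinaryTreeClusters : (n : ℕ) → List (Subset n) → Set
IsBinaryTreeClusters n H =
  Unique H
  × S.⊤ ∈ H
  × (∀ i → ⁅ i ⁆ ∈ H)
  × (∀ U → U ∈ H → S.Nonempty U)
  × (∀ U V → U ∈ H → V ∈ H → U ⊆ V ⊎ V ⊆ U ⊎ Empty (U ∩ V))
  × (∀ U → U ∈ H → 2 ℕ.≤ S.∣ U ∣ →
       ∃[ A ] ∃[ B ] (A ∈ H × B ∈ H × A ≢ U × B ≢ U × Empty (A ∩ B) × A ∪ B ≡ U))

module NeighborNet {c ℓ₁ ℓ₂} (𝓡 : OrderedCommRing c ℓ₁ ℓ₂) where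
  open OrderedCommRing 𝓡

  IsDissimilarity : {n : ℕ} → (Fin n → Fin n → Carrier) → Set (ℓ₁ ⊔ ℓ₂)
  IsDissimilarity δ = (∀ i j → δ i j ≈ δ j i) × (∀ i j → 0# ≤ δ i j) × (∀ i → δ i i ≈ 0#)

  Qcrit : {B : Set} (d : B → B → Carrier) (cs : List B) → Fin (length cs) → Fin (length cs) → Carrier
  Qcrit d cs r s =
    nat (length cs ∸ 2) * d (lookup cs r) (lookup cs s)
    - Σl (exceptOne cs r) (λ C → d (lookup cs r) C)
    - Σl (exceptOne cs s) (λ C → d C (lookup cs s))

  QMinimal : {B : Set} (d : B → B → Carrier) (cs : List B) → Fin (length cs) → Fin (length cs) → Set ℓ₂
  QMinimal d cs r s = ∀ r' s' → r' ≢ s' → Qcrit d cs r s ≤ Qcrit d cs r' s'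

  module _ {n : ℕ} (δ : Fin n → Fin n → Carrier) where

    Block : Set
    Block = List (Fin n)

    Weight : Set c
    Weight = Fin n → Carrier

    δB : Weight → Block → Block → Carrier
    δB μ P Q = Σl P (λ i → Σl Q (λ j → μ i * μ j * δ i j))

    δx : Weight → Fin n → Block → Carrier
    δx μ x Q = Σl Q (λ i → μ i * δ x i)

    IsWeighting : List Block → Weight → Set (ℓ₁ ⊔ ℓ₂)
    IsWeighting cs μ =
      (∀ i → 0# ≤ μ i) × All (λ C → Σl C μ ≈ 1#) cs × All (λ C → All (λ i → 0# < μ i) (ends C)) cs

    Qhat : Weight → (cs : List Block) → Fin (length cs) → Fin (length cs) → Fin n → Fin n → Carrier
    Qhat μ cs r s i j =
      nat ((length cs ℕ.+ length (ends Cr) ℕ.+ length (ends Cs)) ∸ 4) * δ i j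
      - Σl oth (δx μ i) - Σl oth (δx μ j)
      - Σl (filter (λ k → ¬? (k ≟ i)) (Cr ++ Cs)) (δ i)
      - Σl (filter (λ k → ¬? (k ≟ j)) (Cr ++ Cs)) (δ j)
      where
        Cr = lookup cs r
        Cs = lookup cs s
        oth = exceptTwo cs r s

    EndsMinimal : Weight → (cs : List Block) → Fin (length cs) → Fin (length cs) → Fin n → Fin n → Set ℓ₂
    EndsMinimal μ cs r s i j =
      i ∈ ends (lookup cs r) × j ∈ ends (lookup cs s)
      × (∀ i' j' → i' ∈ ends (lookup cs r) → j' ∈ ends (lookup cs s) →
           Qhat μ cs r s i j ≤ Qhat μ cs r s i' j')

    -- A recorded merge: (C_r*, C_s*, label of the adjustment step)
    Merge : Set c → Set c
    Merge L = Subset n × Subset n × L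

    mergedCluster : {L : Set c} → Merge L → Subset n
    mergedCluster (A , B , _) = A ∪ B

    -- The adjustment step is constrained
    -- by a predicate Adj ℓ μ μ' C_r C_s (with label ℓ), in addition to μ'
    -- being a weighting for the new partial circular ordering and agreeing
    -- with μ outside the merged block.
    data NNRun {L : Set c} (Adj : L → Weight → Weight → Block → Block → Set (ℓ₁ ⊔ ℓ₂))
         : List Block → Weight → List (Merge L) → Set (c ⊔ ℓ₁ ⊔ ℓ₂) where
      done : ∀ {C μ} → NNRun Adj (C ∷ []) μ []
      step : ∀ {cs μ rest} (r s : Fin (length cs)) (i j : Fin n) (R : Block) (μ' : Weight) (ℓ : L) →
             r ≢ s →
             QMinimal (δB μ) cs r s →
             EndsMinimal μ cs r s i j →
             Joined (lookup cs r) i (lookup cs s) j R →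
             Adj ℓ μ μ' (lookup cs r) (lookup cs s) →
             (∀ k → k ∉ R → μ' k ≈ μ k) →
             IsWeighting (R ∷ exceptTwo cs r s) μ' →
             NNRun Adj (R ∷ exceptTwo cs r s) μ' rest →
             NNRun Adj cs μ ((toSubset (lookup cs r) , toSubset (lookup cs s) , ℓ) ∷ rest)

    initialBlocks : List Block
    initialBlocks = map (λ i → i ∷ []) (allFin n)

    initialWeight : Weight
    initialWeight _ = 1#

    TreeAdj : Carrier → Weight → Weight → Block → Block → Set (ℓ₁ ⊔ ℓ₂)
    TreeAdj α μ μ' Cr Cs =
      (0# ≤ α × α ≤ 1#)
      × (∀ i → i ∈ Cr → μ' i ≈ α * μ i)
      × (∀ i → i ∈ Cs → μ' i ≈ (1# - α) * μ i)

  _≟ˢ_ : {n : ℕ} (A B : Subset n) → Relation.Nullary.Dec (A ≡ B)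
  _≟ˢ_ = ≡-dec Bool._≟_

  updateD : {n : ℕ} → (Subset n → Subset n → Carrier) → Subset n → Subset n → Carrier →
            Subset n → Subset n → Carrier
  updateD D Cr Cs α A B with A ≟ˢ (Cr ∪ Cs) | B ≟ˢ (Cr ∪ Cs)
  ... | yes _ | yes _ = 0#
  ... | yes _ | no _  = α * D Cr B + (1# - α) * D Cs B
  ... | no _  | yes _ = α * D Cr A + (1# - α) * D Cs A
  ... | no _  | no _  = D A B

  -- NJRun cs D ms : from clusters cs with dissimilarity D, some run of
  -- neighbor joining performs the merges ms = (C_r, C_s, α) in this order,
  -- α being the agglomeration parameter of that step.
  data NJRun {n : ℕ} : List (Subset n) → (Subset n → Subset n → Carrier) →
                       List (Subset n × Subset n × Carrier) → Set (c ⊔ ℓ₁ ⊔ ℓ₂) where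
    done : ∀ {C D} → NJRun (C ∷ []) D []
    step : ∀ {cs D rest} (r s : Fin (length cs)) (α : Carrier) →
           r ≢ s →
           QMinimal D cs r s →
           NJRun ((lookup cs r ∪ lookup cs s) ∷ exceptTwo cs r s)
                 (updateD D (lookup cs r) (lookup cs s) α) rest →
           NJRun cs D ((lookup cs r , lookup cs s , α) ∷ rest)

module Submission where

-- Both parts follow a run of neighbor-net by induction, carrying an invariant of the
-- current partial circular ordering.  For (i): the blocks partition X, and the clusters
-- recorded so far, together with the singletons, form a binary forest whose trees have
-- the current blocks as leaf sets.  A merge adds the union of two roots as a new root
-- with those two as children, so once a single block is left the clusters are those of
-- a binary tree; being laminar, they give pairwise compatible splits.  For (ii): for
-- distinct blocks C, C' the weighted dissimilarity δ_μ(C, C') equals the neighbor-joining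
-- dissimilarity D between the clusters C, C'.  A tree weighting makes δ_μ' from the
-- merged block the α-combination of δ_μ from its two halves, which is exactly the
-- neighbor-joining update, while μ is unchanged on the other blocks.  So both
-- algorithms see the same Q-criterion at every step and make the same choice.

open import Defs
open import Level using (_⊔_)
open import Data.Nat as ℕ using (ℕ; suc; _≤_; _∸_)
open import Data.Fin using (Fin; zero; suc; _≟_; cast)
open import Data.Fin.Properties using (suc-injective; cast-involutive)
open import Data.Fin.Subset as S using (Subset; ⁅_⁆; _∪_; _∩_; ∁; Empty; Nonempty; _⊆_) renaming (_∈_ to _∈ₛ_)
open import Data.Fin.Subset.Properties using (⊆-antisym; ⊆⊤; x∈p∪q⁺; x∈p∪q⁻; x∈p∩q⁺; x∈p∩q⁻; x∈⁅x⁆; x∈⁅y⁆⇒x≡y; x∈∁p⇒x∉p; ∉⊥; p⊆p∪q; q⊆p∪q; ∪-identityʳ; ∣⁅x⁆∣≡1)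
open import Data.List using (List; []; _∷_; _++_; _∷ʳ_; [_]; map; filter; length; lookup; allFin; tabulate; reverse)
open import Data.List.Properties using (length-map; map-∘; map-tabulate; tabulate-lookup; filter-accept; filter-reject; filter-≐; filter-all; unfold-reverse)
import Data.List.Properties as List
open import Data.List.Membership.Propositional using (_∈_; _∉_)
open import Data.List.Membership.Propositional.Properties using (∈-map⁻; ∈-map⁺; ∈-filter⁻; ∈-filter⁺; ∈-allFin; ∈-lookup; ∈-++⁺ˡ; ∈-++⁺ʳ; ∈-++⁻)
open import Data.List.Relation.Unary.Any using (here; there)
open import Data.List.Relation.Unary.Any.Properties using (reverse⁺; reverse⁻; lookup-index)
open import Data.List.Relation.Unary.All as All using (All; _∷_)
open import Data.List.Relation.Unary.AllPairs as AllPairs using (_∷_)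
open import Data.List.Relation.Unary.Unique.Propositional using (Unique)
import Data.List.Relation.Unary.Unique.Propositional.Properties as Unique
open import Data.Product using (∃-syntax; _×_; _,_; proj₁; proj₂)
import Data.Product
open import Data.Sum as Sum using (_⊎_; inj₁; inj₂)
open import Data.Empty using (⊥; ⊥-elim)
open import Function using (_∘_; id)
open import Relation.Binary.PropositionalEquality using (_≡_; _≢_; refl; sym; trans; cong; cong₂; subst; subst₂; module ≡-Reasoning)
open import Relation.Binary.Structures using (IsTotalOrder)
open import Relation.Nullary using (¬_; ¬?; yes; no)
open import Relation.Nullary.Decidable using (_×-dec_)
open import Relation.Unary using (Pred; Decidable; _≐_)

module _ {A B : Set} where

  filter-map : ∀ {p} {P : Pred B p} (P? : Decidable P) (f : A → B) (xs : List A) →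
               filter P? (map f xs) ≡ map f (filter (P? ∘ f) xs)
  filter-map P? f [] = refl
  filter-map P? f (x ∷ xs) with P? (f x)
  ... | yes _ = cong (f x ∷_) (filter-map P? f xs)
  ... | no  _ = filter-map P? f xs

module _ {A : Set} where

  select : ∀ {p} (xs : List A) {P : Pred (Fin (length xs)) p} → Decidable P → List A
  select xs P? = map (lookup xs) (filter P? (allFin (length xs)))

  module _ {p} {x : A} {xs : List A} {P : Pred (Fin (suc (length xs))) p} (P? : Decidable P) where

    private
      select-tail : map (lookup (x ∷ xs)) (filter P? (tabulate suc)) ≡ select xs (P? ∘ suc)
      select-tail = begin
        map (lookup (x ∷ xs)) (filter P? (tabulate suc))
          ≡⟨ cong (map (lookup (x ∷ xs)) ∘ filter P?) (sym (map-tabulate id suc)) ⟩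
        map (lookup (x ∷ xs)) (filter P? (map suc (allFin (length xs))))
          ≡⟨ cong (map (lookup (x ∷ xs))) (filter-map P? suc (allFin (length xs))) ⟩
        map (lookup (x ∷ xs)) (map suc (filter (P? ∘ suc) (allFin (length xs))))
          ≡⟨ map-∘ _ ⟨
        select xs (P? ∘ suc) ∎
        where open ≡-Reasoning

    select-∷-accept : P zero → select (x ∷ xs) P? ≡ x ∷ select xs (P? ∘ suc)
    select-∷-accept p = trans (cong (map (lookup (x ∷ xs))) (filter-accept P? p)) (cong (x ∷_) select-tail)

    select-∷-reject : ¬ P zero → select (x ∷ xs) P? ≡ select xs (P? ∘ suc)
    select-∷-reject ¬p = trans (cong (map (lookup (x ∷ xs))) (filter-reject P? ¬p)) select-tail

  select-≐ : ∀ {p q} (xs : List A) {P : Pred (Fin (length xs)) p} {Q : Pred (Fin (length xs)) q}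
             (P? : Decidable P) (Q? : Decidable Q) → P ≐ Q → select xs P? ≡ select xs Q?
  select-≐ xs P? Q? P≐Q = cong (map (lookup xs)) (filter-≐ P? Q? P≐Q (allFin (length xs)))

  select-all : ∀ {p} (xs : List A) {P : Pred (Fin (length xs)) p} (P? : Decidable P) → (∀ t → P t) → select xs P? ≡ xs
  select-all xs P? all = begin
    map (lookup xs) (filter P? (allFin (length xs))) ≡⟨ cong (map (lookup xs)) (filter-all P? (All.universal all _)) ⟩
    map (lookup xs) (allFin (length xs))             ≡⟨ map-tabulate id (lookup xs) ⟩
    tabulate (lookup xs)                             ≡⟨ tabulate-lookup xs ⟩
    xs                                               ∎
    where open ≡-Reasoning

  private
    ≢? : ∀ {m} (r : Fin m) → Decidable (_≢ r)
    ≢? r t = ¬? (t ≟ r)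

    ≢₂? : ∀ {m} (r s : Fin m) → Decidable (λ t → t ≢ r × t ≢ s)
    ≢₂? r s t = ¬? (t ≟ r) ×-dec ¬? (t ≟ s)

    suc≢suc : ∀ {m} (r : Fin m) → (λ t → suc t ≢ suc r) ≐ (_≢ r)
    suc≢suc r = (λ ne e → ne (cong suc e)) , (λ ne e → ne (suc-injective e))

  module _ (x : A) (xs : List A) where

    exceptOne-∷-zero : exceptOne (x ∷ xs) zero ≡ xs
    exceptOne-∷-zero = trans (select-∷-reject {xs = xs} (≢? zero) (λ ne → ne refl)) (select-all xs _ (λ t ()))

    exceptOne-∷-suc : ∀ r → exceptOne (x ∷ xs) (suc r) ≡ x ∷ exceptOne xs r
    exceptOne-∷-suc r = trans (select-∷-accept {xs = xs} (≢? (suc r)) (λ ()))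
      (cong (x ∷_) (select-≐ xs _ (≢? r) (suc≢suc r)))

    exceptTwo-∷-zero-suc : ∀ s → exceptTwo (x ∷ xs) zero (suc s) ≡ exceptOne xs s
    exceptTwo-∷-zero-suc s = trans (select-∷-reject {xs = xs} (≢₂? zero (suc s)) (λ (ne , _) → ne refl))
      (select-≐ xs _ (≢? s) ((λ (_ , ne) → proj₁ (suc≢suc s) ne) , (λ ne → (λ ()) , proj₂ (suc≢suc s) ne)))

    exceptTwo-∷-suc-zero : ∀ r → exceptTwo (x ∷ xs) (suc r) zero ≡ exceptOne xs r
    exceptTwo-∷-suc-zero r = trans (select-∷-reject {xs = xs} (≢₂? (suc r) zero) (λ (_ , ne) → ne refl))
      (select-≐ xs _ (≢? r) ((λ (ne , _) → proj₁ (suc≢suc r) ne) , (λ ne → proj₂ (suc≢suc r) ne , (λ ()))))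

    exceptTwo-∷-suc-suc : ∀ r s → exceptTwo (x ∷ xs) (suc r) (suc s) ≡ x ∷ exceptTwo xs r s
    exceptTwo-∷-suc-suc r s = trans (select-∷-accept {xs = xs} (≢₂? (suc r) (suc s)) ((λ ()) , (λ ())))
      (cong (x ∷_) (select-≐ xs _ (≢₂? r s) (Data.Product.map (proj₁ (suc≢suc r)) (proj₁ (suc≢suc s))
                                            , Data.Product.map (proj₂ (suc≢suc r)) (proj₂ (suc≢suc s)))))

  length-exceptOne : (xs : List A) (r : Fin (length xs)) → suc (length (exceptOne xs r)) ≡ length xs
  length-exceptOne (x ∷ xs) zero    = cong (suc ∘ length) (exceptOne-∷-zero x xs)
  length-exceptOne (x ∷ xs) (suc r) = cong suc (trans (cong length (exceptOne-∷-suc x xs r)) (length-exceptOne xs r))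

  length-exceptTwo : (xs : List A) (r s : Fin (length xs)) → r ≢ s →
                     suc (length (exceptTwo xs r s)) ≡ length xs ∸ 1
  length-exceptTwo (x ∷ xs) zero zero r≢s = ⊥-elim (r≢s refl)
  length-exceptTwo (x ∷ xs) zero (suc s) _ =
    trans (cong (suc ∘ length) (exceptTwo-∷-zero-suc x xs s)) (length-exceptOne xs s)
  length-exceptTwo (x ∷ xs) (suc r) zero _ =
    trans (cong (suc ∘ length) (exceptTwo-∷-suc-zero x xs r)) (length-exceptOne xs r)
  length-exceptTwo (x ∷ y ∷ ys) (suc r) (suc s) r≢s =
    cong suc (trans (cong length (exceptTwo-∷-suc-suc x (y ∷ ys) r s)) (length-exceptTwo (y ∷ ys) r s (r≢s ∘ cong suc)))

  lookup-injective : {xs : List A} → Unique xs → {i j : Fin (length xs)} → lookup xs i ≡ lookup xs j → i ≡ j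
  lookup-injective {_ ∷ _} _               {zero}  {zero}  _ = refl
  lookup-injective {_ ∷ _} (x∉xs ∷ _)      {zero}  {suc j} e = ⊥-elim (All.lookup x∉xs (∈-lookup j) e)
  lookup-injective {_ ∷ _} (x∉xs ∷ _)      {suc i} {zero}  e = ⊥-elim (All.lookup x∉xs (∈-lookup i) (sym e))
  lookup-injective {_ ∷ _} (_ ∷ xs-unique) {suc i} {suc j} e = cong suc (lookup-injective xs-unique e)

  ∈-exceptOne⁻ : {xs : List A} {r : Fin (length xs)} {C : A} → C ∈ exceptOne xs r →
                 ∃[ t ] (t ≢ r × lookup xs t ≡ C)
  ∈-exceptOne⁻ {xs} {r} C∈ with t , t∈ , refl ← ∈-map⁻ (lookup xs) C∈ =
    t , proj₂ (∈-filter⁻ (≢? r) {xs = allFin (length xs)} t∈) , refl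

  ∈-exceptTwo⁻ : {xs : List A} {r s : Fin (length xs)} {C : A} → C ∈ exceptTwo xs r s →
                 ∃[ t ] (t ≢ r × t ≢ s × lookup xs t ≡ C)
  ∈-exceptTwo⁻ {xs} {r} {s} C∈ with t , t∈ , refl ← ∈-map⁻ (lookup xs) C∈ =
    t , Data.Product.map₂ (_, refl) (proj₂ (∈-filter⁻ (≢₂? r s) {xs = allFin (length xs)} t∈))

  ∈-exceptTwo⁺ : {xs : List A} {r s t : Fin (length xs)} → t ≢ r → t ≢ s → lookup xs t ∈ exceptTwo xs r s
  ∈-exceptTwo⁺ {xs} {r} {s} {t} t≢r t≢s = ∈-map⁺ (lookup xs) (∈-filter⁺ (≢₂? r s) (∈-allFin t) (t≢r , t≢s))

  exceptTwo-unique : {xs : List A} → Unique xs → (r s : Fin (length xs)) → Unique (exceptTwo xs r s)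
  exceptTwo-unique {xs} xs-unique r s =
    Unique.map⁺ (lookup-injective xs-unique) (Unique.filter⁺ (≢₂? r s) (Unique.allFin⁺ (length xs)))

  ∈-exceptOne⇒other : {xs : List A} {r : Fin (length xs)} {C : A} → Unique xs → C ∈ exceptOne xs r →
                      C ∈ xs × C ≢ lookup xs r
  ∈-exceptOne⇒other {xs} xs-unique C∈ with t , t≢r , refl ← ∈-exceptOne⁻ {xs = xs} C∈ =
    ∈-lookup t , t≢r ∘ lookup-injective xs-unique

module _ {A B : Set} (f : A → B) where

  mapIndex : (xs : List A) → Fin (length xs) → Fin (length (map f xs))
  mapIndex xs = cast (sym (length-map f xs))

  mapIndex-injective : (xs : List A) {i j : Fin (length xs)} → mapIndex xs i ≡ mapIndex xs j → i ≡ j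
  mapIndex-injective xs {i} {j} e = begin
    i                                          ≡⟨ cast-involutive (length-map f xs) _ i ⟨
    cast (length-map f xs) (mapIndex xs i)     ≡⟨ cong (cast (length-map f xs)) e ⟩
    cast (length-map f xs) (mapIndex xs j)     ≡⟨ cast-involutive (length-map f xs) _ j ⟩
    j                                          ∎
    where open ≡-Reasoning

  mapIndex-surjective : (xs : List A) (a : Fin (length (map f xs))) → mapIndex xs (cast (length-map f xs) a) ≡ a
  mapIndex-surjective xs a = cast-involutive (sym (length-map f xs)) (length-map f xs) a

  lookup-mapIndex : (xs : List A) (i : Fin (length xs)) → lookup (map f xs) (mapIndex xs i) ≡ f (lookup xs i)
  lookup-mapIndex (x ∷ xs) zero    = refl
  lookup-mapIndex (x ∷ xs) (suc i) = lookup-mapIndex xs i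

  exceptOne-map : (xs : List A) (r : Fin (length xs)) → map f (exceptOne xs r) ≡ exceptOne (map f xs) (mapIndex xs r)
  exceptOne-map (x ∷ xs) zero = trans (cong (map f) (exceptOne-∷-zero x xs)) (sym (exceptOne-∷-zero (f x) (map f xs)))
  exceptOne-map (x ∷ xs) (suc r) = trans (cong (map f) (exceptOne-∷-suc x xs r))
    (trans (cong (f x ∷_) (exceptOne-map xs r)) (sym (exceptOne-∷-suc (f x) (map f xs) (mapIndex xs r))))

  exceptTwo-map : (xs : List A) (r s : Fin (length xs)) → r ≢ s →
                  map f (exceptTwo xs r s) ≡ exceptTwo (map f xs) (mapIndex xs r) (mapIndex xs s)
  exceptTwo-map (x ∷ xs) zero zero r≢s = ⊥-elim (r≢s refl)
  exceptTwo-map (x ∷ xs) zero (suc s) _ = trans (cong (map f) (exceptTwo-∷-zero-suc x xs s))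
    (trans (exceptOne-map xs s) (sym (exceptTwo-∷-zero-suc (f x) (map f xs) (mapIndex xs s))))
  exceptTwo-map (x ∷ xs) (suc r) zero _ = trans (cong (map f) (exceptTwo-∷-suc-zero x xs r))
    (trans (exceptOne-map xs r) (sym (exceptTwo-∷-suc-zero (f x) (map f xs) (mapIndex xs r))))
  exceptTwo-map (x ∷ xs) (suc r) (suc s) r≢s = trans (cong (map f) (exceptTwo-∷-suc-suc x xs r s))
    (trans (cong (f x ∷_) (exceptTwo-map xs r s (r≢s ∘ cong suc)))
           (sym (exceptTwo-∷-suc-suc (f x) (map f xs) (mapIndex xs r) (mapIndex xs s))))

module _ {n : ℕ} where

  ∈-toSubset⁺ : ∀ {k} (C : List (Fin n)) → k ∈ C → k ∈ₛ toSubset C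
  ∈-toSubset⁺ (x ∷ _) (here refl) = x∈p∪q⁺ (inj₁ (x∈⁅x⁆ x))
  ∈-toSubset⁺ (_ ∷ C) (there k∈)  = x∈p∪q⁺ (inj₂ (∈-toSubset⁺ C k∈))

  ∈-toSubset⁻ : ∀ {k} (C : List (Fin n)) → k ∈ₛ toSubset C → k ∈ C
  ∈-toSubset⁻ []      k∈ = ⊥-elim (∉⊥ k∈)
  ∈-toSubset⁻ (x ∷ C) k∈ with x∈p∪q⁻ ⁅ x ⁆ (toSubset C) k∈
  ... | inj₁ k∈x = here (x∈⁅y⁆⇒x≡y x k∈x)
  ... | inj₂ k∈C = there (∈-toSubset⁻ C k∈C)

  Reorientation : List (Fin n) → List (Fin n) → Set
  Reorientation P' P = P' ≡ P ⊎ P' ≡ reverse P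

  private
    ∈-reoriented⁻ : ∀ {k P' P} → Reorientation P' P → k ∈ P' → k ∈ P
    ∈-reoriented⁻ (inj₁ refl) = id
    ∈-reoriented⁻ (inj₂ refl) = reverse⁻

    ∈-reoriented⁺ : ∀ {k P' P} → Reorientation P' P → k ∈ P → k ∈ P'
    ∈-reoriented⁺ (inj₁ refl) = id
    ∈-reoriented⁺ (inj₂ refl) = reverse⁺

  module _ {P Q R : List (Fin n)} {i j : Fin n} where

    ∈-joined⁻ : ∀ {k} → Joined P i Q j R → k ∈ R → k ∈ P ⊎ k ∈ Q
    ∈-joined⁻ (P' , _ , P'~P , Q'~Q , _ , _ , refl) k∈ =
      Sum.map (∈-reoriented⁻ P'~P) (∈-reoriented⁻ Q'~Q) (∈-++⁻ P' k∈)

    ∈-joined⁺ˡ : ∀ {k} → Joined P i Q j R → k ∈ P → k ∈ R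
    ∈-joined⁺ˡ (_ , _ , P'~P , _ , _ , _ , refl) = ∈-++⁺ˡ ∘ ∈-reoriented⁺ P'~P

    ∈-joined⁺ʳ : ∀ {k} → Joined P i Q j R → k ∈ Q → k ∈ R
    ∈-joined⁺ʳ (P' , _ , _ , Q'~Q , _ , _ , refl) = ∈-++⁺ʳ P' ∘ ∈-reoriented⁺ Q'~Q

    toSubset-joined : Joined P i Q j R → toSubset R ≡ toSubset P ∪ toSubset Q
    toSubset-joined J = ⊆-antisym
      (λ k∈ → x∈p∪q⁺ (Sum.map (∈-toSubset⁺ P) (∈-toSubset⁺ Q) (∈-joined⁻ J (∈-toSubset⁻ R k∈))))
      (λ k∈ → ∈-toSubset⁺ R (Sum.[ ∈-joined⁺ˡ J ∘ ∈-toSubset⁻ P , ∈-joined⁺ʳ J ∘ ∈-toSubset⁻ Q ] (x∈p∪q⁻ _ _ k∈)))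

  record IsPartition (bs : List (List (Fin n))) : Set where
    field
      unique   : Unique bs
      nonempty : ∀ {C} → C ∈ bs → ∃[ k ] k ∈ C
      disjoint : ∀ {C C' k} → C ∈ bs → C' ∈ bs → C ≢ C' → k ∈ C → k ∈ C' → ⊥
      covering : ∀ k → ∃[ C ] (C ∈ bs × k ∈ C)

    sameBlock : ∀ {C C' k} → C ∈ bs → C' ∈ bs → k ∈ C → k ∈ C' → C ≡ C'
    sameBlock {C} {C'} C∈ C'∈ k∈C k∈C' with List.≡-dec _≟_ C C'
    ... | yes C≡C' = C≡C'
    ... | no  C≢C' = ⊥-elim (disjoint C∈ C'∈ C≢C' k∈C k∈C')

  module Merging {bs : List (List (Fin n))} (part : IsPartition bs)
                 {r s : Fin (length bs)} (r≢s : r ≢ s)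
                 {i j : Fin n} {R : List (Fin n)} (J : Joined (lookup bs r) i (lookup bs s) j R) where

    open IsPartition part

    Cr Cs : List (Fin n)
    Cr = lookup bs r
    Cs = lookup bs s

    rest : List (List (Fin n))
    rest = exceptTwo bs r s

    Cr∈ : Cr ∈ bs
    Cr∈ = ∈-lookup r

    Cs∈ : Cs ∈ bs
    Cs∈ = ∈-lookup s

    Cr≢Cs : Cr ≢ Cs
    Cr≢Cs = r≢s ∘ lookup-injective unique

    ∈-rest⁻ : ∀ {C} → C ∈ rest → C ∈ bs × C ≢ Cr × C ≢ Cs
    ∈-rest⁻ C∈ with t , t≢r , t≢s , refl ← ∈-exceptTwo⁻ {xs = bs} C∈ =
      ∈-lookup t , t≢r ∘ lookup-injective unique , t≢s ∘ lookup-injective unique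

    ∈-rest⁺ : ∀ {C} → C ∈ bs → C ≢ Cr → C ≢ Cs → C ∈ rest
    ∈-rest⁺ C∈ C≢Cr C≢Cs = subst (_∈ rest) (sym C≡) (∈-exceptTwo⁺ {xs = bs}
        (λ t≡r → C≢Cr (trans C≡ (cong (lookup bs) t≡r))) (λ t≡s → C≢Cs (trans C≡ (cong (lookup bs) t≡s))))
      where C≡ = lookup-index C∈

    rest-disjoint-joined : ∀ {C k} → C ∈ rest → k ∈ C → k ∉ R
    rest-disjoint-joined C∈ k∈C k∈R with C∈bs , C≢Cr , C≢Cs ← ∈-rest⁻ C∈ with ∈-joined⁻ J k∈R
    ... | inj₁ k∈Cr = disjoint C∈bs Cr∈ C≢Cr k∈C k∈Cr
    ... | inj₂ k∈Cs = disjoint C∈bs Cs∈ C≢Cs k∈C k∈Cs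

    joined∉rest : R ∉ rest
    joined∉rest R∈ = let k , k∈Cr = nonempty Cr∈; k∈R = ∈-joined⁺ˡ J k∈Cr in
      rest-disjoint-joined R∈ k∈R k∈R

    merge-isPartition : IsPartition (R ∷ rest)
    merge-isPartition = record
      { unique   = All.tabulate (λ C∈ R≡C → joined∉rest (subst (_∈ rest) (sym R≡C) C∈)) ∷ exceptTwo-unique unique r s
      ; nonempty = λ { (here refl) → Data.Product.map₂ (∈-joined⁺ˡ J) (nonempty Cr∈)
                     ; (there C∈)  → nonempty (proj₁ (∈-rest⁻ C∈)) }
      ; disjoint = disjoint'
      ; covering = covering'
      }
      where
        disjoint' : ∀ {C C' k} → C ∈ R ∷ rest → C' ∈ R ∷ rest → C ≢ C' → k ∈ C → k ∈ C' → ⊥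
        disjoint' (here refl) (here refl) C≢C' _    _     = C≢C' refl
        disjoint' (here refl) (there C'∈) _    k∈R k∈C'  = rest-disjoint-joined C'∈ k∈C' k∈R
        disjoint' (there C∈)  (here refl) _    k∈C  k∈R  = rest-disjoint-joined C∈ k∈C k∈R
        disjoint' (there C∈)  (there C'∈) C≢C' k∈C  k∈C' =
          disjoint (proj₁ (∈-rest⁻ C∈)) (proj₁ (∈-rest⁻ C'∈)) C≢C' k∈C k∈C'

        covering' : ∀ k → ∃[ C ] (C ∈ R ∷ rest × k ∈ C)
        covering' k with C , C∈ , k∈C ← covering k with List.≡-dec _≟_ C Cr | List.≡-dec _≟_ C Cs
        ... | yes refl | _        = R , here refl , ∈-joined⁺ˡ J k∈C
        ... | no _     | yes refl = R , here refl , ∈-joined⁺ʳ J k∈C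
        ... | no C≢Cr  | no C≢Cs  = C , there (∈-rest⁺ C∈ C≢Cr C≢Cs) , k∈C

  NestedOrDisjoint : Subset n → Subset n → Set
  NestedOrDisjoint U V = U ⊆ V ⊎ V ⊆ U ⊎ Empty (U ∩ V)

  nestedOrDisjoint-sym : ∀ {U V} → NestedOrDisjoint U V → NestedOrDisjoint V U
  nestedOrDisjoint-sym         (inj₁ U⊆V)         = inj₂ (inj₁ U⊆V)
  nestedOrDisjoint-sym         (inj₂ (inj₁ V⊆U))  = inj₁ V⊆U
  nestedOrDisjoint-sym {U} {V} (inj₂ (inj₂ U∩V=∅)) =
    inj₂ (inj₂ λ (k , k∈V∩U) → U∩V=∅ (k , x∈p∩q⁺ (Data.Product.swap (x∈p∩q⁻ V U k∈V∩U))))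

  nestedOrDisjoint⇒compatible : ∀ {U V} → NestedOrDisjoint U V → Compatible U V
  nestedOrDisjoint⇒compatible {U} {V} (inj₁ U⊆V) =
    inj₂ (inj₁ λ (k , k∈) → let k∈U , k∈∁V = x∈p∩q⁻ U (∁ V) k∈ in x∈∁p⇒x∉p k∈∁V (U⊆V k∈U))
  nestedOrDisjoint⇒compatible {U} {V} (inj₂ (inj₁ V⊆U)) =
    inj₂ (inj₂ (inj₁ λ (k , k∈) → let k∈∁U , k∈V = x∈p∩q⁻ (∁ U) V k∈ in x∈∁p⇒x∉p k∈∁U (V⊆U k∈V)))
  nestedOrDisjoint⇒compatible (inj₂ (inj₂ U∩V=∅)) = inj₁ U∩V=∅

  Laminar : List (Subset n) → Set
  Laminar H = ∀ U V → U ∈ H → V ∈ H → NestedOrDisjoint U V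

  laminar⇒pairwiseCompatible : ∀ {H} → Laminar H → PairwiseCompatible H
  laminar⇒pairwiseCompatible laminar U V U∈ V∈ _ = nestedOrDisjoint⇒compatible (laminar U V U∈ V∈)

  BinaryBranching : List (Subset n) → Set
  BinaryBranching H = ∀ U → U ∈ H → 2 ℕ.≤ S.∣ U ∣ →
    ∃[ A ] ∃[ B ] (A ∈ H × B ∈ H × A ≢ U × B ≢ U × Empty (A ∩ B) × A ∪ B ≡ U)

  -- H is the cluster system of a binary forest whose trees have the blocks of bs as leaf sets.
  record IsForestOver (bs : List (List (Fin n))) (H : List (Subset n)) : Set where
    field
      distinct    : Unique H
      singletons  : ∀ i → ⁅ i ⁆ ∈ H
      blocks      : ∀ {C} → C ∈ bs → toSubset C ∈ H
      inhabited   : ∀ U → U ∈ H → Nonempty U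
      laminar     : Laminar H
      branching   : BinaryBranching H
      withinBlock : ∀ {U} → U ∈ H → ∃[ C ] (C ∈ bs × U ⊆ toSubset C)

  private
    ∈-∷ʳ⁻ : ∀ {A : Set} {xs : List A} {x y} → y ∈ xs ∷ʳ x → y ∈ xs ⊎ y ≡ x
    ∈-∷ʳ⁻ {xs = xs} y∈ with ∈-++⁻ xs y∈
    ... | inj₁ y∈xs        = inj₁ y∈xs
    ... | inj₂ (here y≡x) = inj₂ y≡x

  module ForestMerging {bs : List (List (Fin n))} (part : IsPartition bs)
                       {r s : Fin (length bs)} (r≢s : r ≢ s)
                       {i j : Fin n} {R : List (Fin n)} (J : Joined (lookup bs r) i (lookup bs s) j R)
                       {H : List (Subset n)} (forest : IsForestOver bs H) where

    open IsPartition part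
    open Merging part r≢s J
    open IsForestOver forest

    merged : Subset n
    merged = toSubset Cr ∪ toSubset Cs

    ∈-merged⁻ : ∀ {k} → k ∈ₛ merged → k ∈ Cr ⊎ k ∈ Cs
    ∈-merged⁻ k∈ = Sum.map (∈-toSubset⁻ Cr) (∈-toSubset⁻ Cs) (x∈p∪q⁻ _ _ k∈)

    ∈-merged⁺ʳ : ∀ {k} → k ∈ Cs → k ∈ₛ merged
    ∈-merged⁺ʳ = x∈p∪q⁺ ∘ inj₂ ∘ ∈-toSubset⁺ Cs

    ∈-merged⁺ˡ : ∀ {k} → k ∈ Cr → k ∈ₛ merged
    ∈-merged⁺ˡ = x∈p∪q⁺ ∘ inj₁ ∘ ∈-toSubset⁺ Cr

    merged∉H : merged ∉ H
    merged∉H merged∈ with C , C∈ , merged⊆C ← withinBlock merged∈ =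
      let kr , kr∈Cr = nonempty Cr∈
          ks , ks∈Cs = nonempty Cs∈
          C≡Cr = sameBlock C∈ Cr∈ (∈-toSubset⁻ C (merged⊆C (∈-merged⁺ˡ kr∈Cr))) kr∈Cr
          C≡Cs = sameBlock C∈ Cs∈ (∈-toSubset⁻ C (merged⊆C (∈-merged⁺ʳ ks∈Cs))) ks∈Cs
      in Cr≢Cs (trans (sym C≡Cr) C≡Cs)

    nestedOrDisjoint-merged : ∀ {U} → U ∈ H → NestedOrDisjoint U merged
    nestedOrDisjoint-merged {U} U∈ with C , C∈ , U⊆C ← withinBlock U∈
                                   with List.≡-dec _≟_ C Cr | List.≡-dec _≟_ C Cs
    ... | yes refl | _        = inj₁ (p⊆p∪q (toSubset Cs) ∘ U⊆C)
    ... | no _     | yes refl = inj₁ (q⊆p∪q (toSubset Cr) (toSubset Cs) ∘ U⊆C)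
    ... | no C≢Cr  | no C≢Cs  = inj₂ (inj₂ λ (k , k∈) →
      let k∈U , k∈merged = x∈p∩q⁻ U merged k∈
          k∈C = ∈-toSubset⁻ C (U⊆C k∈U)
      in Sum.[ C≢Cr ∘ sameBlock C∈ Cr∈ k∈C , C≢Cs ∘ sameBlock C∈ Cs∈ k∈C ] (∈-merged⁻ k∈merged))

    merged-children : ∃[ A ] ∃[ B ] (A ∈ H × B ∈ H × A ≢ merged × B ≢ merged × Empty (A ∩ B) × A ∪ B ≡ merged)
    merged-children =
      toSubset Cr , toSubset Cs , blocks Cr∈ , blocks Cs∈
      , (λ Cr≡merged → let ks , ks∈Cs = nonempty Cs∈ in
           Cr≢Cs (sameBlock Cr∈ Cs∈ (∈-toSubset⁻ Cr (subst (ks ∈ₛ_) (sym Cr≡merged) (∈-merged⁺ʳ ks∈Cs))) ks∈Cs))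
      , (λ Cs≡merged → let kr , kr∈Cr = nonempty Cr∈ in
           Cr≢Cs (sameBlock Cr∈ Cs∈ kr∈Cr (∈-toSubset⁻ Cs (subst (kr ∈ₛ_) (sym Cs≡merged) (∈-merged⁺ˡ kr∈Cr)))))
      , (λ (k , k∈) → let k∈Cr , k∈Cs = x∈p∩q⁻ (toSubset Cr) (toSubset Cs) k∈ in
           Cr≢Cs (sameBlock Cr∈ Cs∈ (∈-toSubset⁻ Cr k∈Cr) (∈-toSubset⁻ Cs k∈Cs)))
      , refl

    merged∈ : merged ∈ H ∷ʳ merged
    merged∈ = ∈-++⁺ʳ H (here refl)

    ⊆-joined : ∀ {U} → U ⊆ merged → U ⊆ toSubset R
    ⊆-joined = subst (_ ⊆_) (sym (toSubset-joined J))

    merge-blocks : ∀ {C} → C ∈ R ∷ rest → toSubset C ∈ H ∷ʳ merged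
    merge-blocks (here refl) = subst (_∈ H ∷ʳ merged) (sym (toSubset-joined J)) merged∈
    merge-blocks (there C∈)  = ∈-++⁺ˡ (blocks (proj₁ (∈-rest⁻ C∈)))

    merge-inhabited : ∀ U → U ∈ H ∷ʳ merged → Nonempty U
    merge-inhabited U U∈ with ∈-∷ʳ⁻ U∈
    ... | inj₁ U∈H  = inhabited U U∈H
    ... | inj₂ refl = Data.Product.map₂ ∈-merged⁺ˡ (nonempty Cr∈)

    merge-laminar : Laminar (H ∷ʳ merged)
    merge-laminar U V U∈ V∈ with ∈-∷ʳ⁻ U∈ | ∈-∷ʳ⁻ V∈
    ... | inj₁ U∈H  | inj₁ V∈H  = laminar U V U∈H V∈H
    ... | inj₁ U∈H  | inj₂ refl = nestedOrDisjoint-merged U∈H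
    ... | inj₂ refl | inj₁ V∈H  = nestedOrDisjoint-sym (nestedOrDisjoint-merged V∈H)
    ... | inj₂ refl | inj₂ refl = inj₁ id

    merge-branching : BinaryBranching (H ∷ʳ merged)
    merge-branching U U∈ 2≤∣U∣ with ∈-∷ʳ⁻ U∈
    ... | inj₁ U∈H  with A , B , A∈ , B∈ , children ← branching U U∈H 2≤∣U∣ = A , B , ∈-++⁺ˡ A∈ , ∈-++⁺ˡ B∈ , children
    ... | inj₂ refl with A , B , A∈ , B∈ , children ← merged-children       = A , B , ∈-++⁺ˡ A∈ , ∈-++⁺ˡ B∈ , children

    merge-withinBlock : ∀ {U} → U ∈ H ∷ʳ merged → ∃[ C ] (C ∈ R ∷ rest × U ⊆ toSubset C)
    merge-withinBlock U∈ with ∈-∷ʳ⁻ U∈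
    ... | inj₂ refl = R , here refl , ⊆-joined id
    ... | inj₁ U∈H with C , C∈ , U⊆C ← withinBlock U∈H with List.≡-dec _≟_ C Cr | List.≡-dec _≟_ C Cs
    ... | yes refl | _        = R , here refl , ⊆-joined (p⊆p∪q (toSubset Cs) ∘ U⊆C)
    ... | no _     | yes refl = R , here refl , ⊆-joined (q⊆p∪q (toSubset Cr) (toSubset Cs) ∘ U⊆C)
    ... | no C≢Cr  | no C≢Cs  = C , there (∈-rest⁺ C∈ C≢Cr C≢Cs) , U⊆C

    merge-isForestOver : IsForestOver (R ∷ rest) (H ∷ʳ merged)
    merge-isForestOver = record
      { distinct    = Unique.++⁺ distinct (All.[] ∷ AllPairs.[]) λ { (U∈H , here refl) → merged∉H U∈H }
      ; singletons  = ∈-++⁺ˡ ∘ singletons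
      ; blocks      = merge-blocks
      ; inhabited   = merge-inhabited
      ; laminar     = merge-laminar
      ; branching   = merge-branching
      ; withinBlock = merge-withinBlock
      }

  singleBlock-isBinaryTree : ∀ {C H} → IsPartition (C ∷ []) → IsForestOver (C ∷ []) H → IsBinaryTreeClusters n H
  singleBlock-isBinaryTree {C} {H} part forest =
    distinct , subst (_∈ H) toSubset-C≡⊤ (blocks (here refl)) , singletons , inhabited , laminar , branching
    where
      open IsPartition part
      open IsForestOver forest

      covered : ∀ k → k ∈ C
      covered k with covering k
      ... | _ , here refl , k∈C = k∈C
      ... | _ , there () , _

      toSubset-C≡⊤ : toSubset C ≡ S.⊤
      toSubset-C≡⊤ = ⊆-antisym ⊆⊤ (λ {k} _ → ∈-toSubset⁺ C (covered k))

  singletonBlocks-isPartition : IsPartition (map [_] (allFin n))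
  singletonBlocks-isPartition = record
    { unique   = Unique.map⁺ (λ { refl → refl }) (Unique.allFin⁺ n)
    ; nonempty = λ C∈ → let i , _ , C≡[i] = ∈-map⁻ [_] C∈ in i , subst (i ∈_) (sym C≡[i]) (here refl)
    ; disjoint = disjoint'
    ; covering = λ k → [ k ] , ∈-map⁺ [_] (∈-allFin k) , here refl
    }
    where
      disjoint' : ∀ {C C' k} → C ∈ map [_] (allFin n) → C' ∈ map [_] (allFin n) → C ≢ C' → k ∈ C → k ∈ C' → ⊥
      disjoint' C∈ C'∈ C≢C' k∈C k∈C' with ∈-map⁻ [_] C∈ | ∈-map⁻ [_] C'∈
      disjoint' _ _ C≢C' (here refl) (here refl) | _ , _ , refl | _ , _ , refl = C≢C' refl

  toSubset-[_] : ∀ (i : Fin n) → toSubset [ i ] ≡ ⁅ i ⁆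
  toSubset-[ i ] = ∪-identityʳ ⁅ i ⁆

  singletonSets-isForestOver : IsForestOver (map [_] (allFin n)) (singletonSets n)
  singletonSets-isForestOver = record
    { distinct    = Unique.map⁺ (λ {i} {j} ⁅i⁆≡⁅j⁆ → x∈⁅y⁆⇒x≡y j (subst (i ∈ₛ_) ⁅i⁆≡⁅j⁆ (x∈⁅x⁆ i))) (Unique.allFin⁺ n)
    ; singletons  = λ i → ∈-map⁺ ⁅_⁆ (∈-allFin i)
    ; blocks      = blocks'
    ; inhabited   = inhabited'
    ; laminar     = laminar'
    ; branching   = branching'
    ; withinBlock = withinBlock'
    }
    where
      blocks' : ∀ {C} → C ∈ map [_] (allFin n) → toSubset C ∈ singletonSets n
      blocks' C∈ with i , _ , refl ← ∈-map⁻ [_] C∈ = subst (_∈ singletonSets n) (sym toSubset-[ i ]) (∈-map⁺ ⁅_⁆ (∈-allFin i))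

      inhabited' : ∀ U → U ∈ singletonSets n → Nonempty U
      inhabited' U U∈ with i , _ , refl ← ∈-map⁻ ⁅_⁆ U∈ = i , x∈⁅x⁆ i

      laminar' : Laminar (singletonSets n)
      laminar' U V U∈ V∈ with i , _ , refl ← ∈-map⁻ ⁅_⁆ U∈ with j , _ , refl ← ∈-map⁻ ⁅_⁆ V∈ with i ≟ j
      ... | yes refl = inj₁ id
      ... | no i≢j   = inj₂ (inj₂ λ (k , k∈) → let k∈⁅i⁆ , k∈⁅j⁆ = x∈p∩q⁻ ⁅ i ⁆ ⁅ j ⁆ k∈ in
                         i≢j (trans (sym (x∈⁅y⁆⇒x≡y i k∈⁅i⁆)) (x∈⁅y⁆⇒x≡y j k∈⁅j⁆)))

      branching' : BinaryBranching (singletonSets n)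
      branching' U U∈ 2≤∣U∣ with i , _ , refl ← ∈-map⁻ ⁅_⁆ U∈ with subst (2 ℕ.≤_) (∣⁅x⁆∣≡1 i) 2≤∣U∣
      ... | ℕ.s≤s ()

      withinBlock' : ∀ {U} → U ∈ singletonSets n → ∃[ C ] (C ∈ map [_] (allFin n) × U ⊆ toSubset C)
      withinBlock' U∈ with i , _ , refl ← ∈-map⁻ ⁅_⁆ U∈ = [ i ] , ∈-map⁺ [_] (∈-allFin i) , x∈p∪q⁺ ∘ inj₁

  length-singletonBlocks : length (map [_] (allFin n)) ≡ n
  length-singletonBlocks = trans (length-map [_] (allFin n)) (List.length-tabulate id)

  map-toSubset-singletonBlocks : map toSubset (map [_] (allFin n)) ≡ singletonSets n
  map-toSubset-singletonBlocks = trans (sym (map-∘ (allFin n))) (List.map-cong toSubset-[_] (allFin n))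

module _ {c ℓ₁ ℓ₂} (𝓡 : OrderedCommRing c ℓ₁ ℓ₂) where

  open OrderedCommRing 𝓡 renaming (refl to ≈-refl; sym to ≈-sym; trans to ≈-trans; _≤_ to _≤ᴿ_)
  open NeighborNet 𝓡
  open import Algebra.Properties.CommutativeSemigroup +-commutativeSemigroup using (interchange)
  open import Relation.Binary.Reasoning.Setoid setoid

  Σl-cong : ∀ {A : Set} (xs : List A) {f g : A → Carrier} → (∀ {x} → x ∈ xs → f x ≈ g x) → Σl xs f ≈ Σl xs g
  Σl-cong []       f≈g = ≈-refl
  Σl-cong (x ∷ xs) f≈g = +-cong (f≈g (here refl)) (Σl-cong xs (f≈g ∘ there))

  Σl-++ : ∀ {A : Set} (xs ys : List A) (f : A → Carrier) → Σl (xs ++ ys) f ≈ Σl xs f + Σl ys f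
  Σl-++ []       ys f = ≈-sym (+-identityˡ _)
  Σl-++ (x ∷ xs) ys f = ≈-trans (+-cong ≈-refl (Σl-++ xs ys f)) (≈-sym (+-assoc _ _ _))

  Σl-reverse : ∀ {A : Set} (xs : List A) (f : A → Carrier) → Σl (reverse xs) f ≈ Σl xs f
  Σl-reverse []       f = ≈-refl
  Σl-reverse (x ∷ xs) f = begin
    Σl (reverse (x ∷ xs)) f         ≡⟨ cong (λ ys → Σl ys f) (unfold-reverse x xs) ⟩
    Σl (reverse xs ++ [ x ]) f      ≈⟨ Σl-++ (reverse xs) [ x ] f ⟩
    Σl (reverse xs) f + (f x + 0#)  ≈⟨ +-cong (Σl-reverse xs f) (+-identityʳ _) ⟩
    Σl xs f + f x                   ≈⟨ +-comm _ _ ⟩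
    f x + Σl xs f                   ∎

  Σl-+ : ∀ {A : Set} (xs : List A) (f g : A → Carrier) → Σl xs (λ x → f x + g x) ≈ Σl xs f + Σl xs g
  Σl-+ []       f g = ≈-sym (+-identityʳ _)
  Σl-+ (x ∷ xs) f g = ≈-trans (+-cong ≈-refl (Σl-+ xs f g)) (interchange _ _ _ _)

  Σl-*ˡ : ∀ {A : Set} (xs : List A) (a : Carrier) (f : A → Carrier) → Σl xs (λ x → a * f x) ≈ a * Σl xs f
  Σl-*ˡ []       a f = ≈-sym (zeroʳ a)
  Σl-*ˡ (x ∷ xs) a f = ≈-trans (+-cong ≈-refl (Σl-*ˡ xs a f)) (≈-sym (distribˡ a _ _))

  Σl-zero : ∀ {A : Set} (xs : List A) → Σl xs (λ _ → 0#) ≈ 0#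
  Σl-zero []       = ≈-refl
  Σl-zero (x ∷ xs) = ≈-trans (+-identityˡ _) (Σl-zero xs)

  Σl-swap : ∀ {A B : Set} (xs : List A) (ys : List B) (f : A → B → Carrier) →
            Σl xs (λ x → Σl ys (f x)) ≈ Σl ys (λ y → Σl xs (λ x → f x y))
  Σl-swap []       ys f = ≈-sym (Σl-zero ys)
  Σl-swap (x ∷ xs) ys f = ≈-trans (+-cong ≈-refl (Σl-swap xs ys f)) (≈-sym (Σl-+ ys (f x) _))

  Σl-map : ∀ {A B : Set} (h : A → B) (xs : List A) (f : B → Carrier) → Σl (map h xs) f ≡ Σl xs (f ∘ h)
  Σl-map h []       f = refl
  Σl-map h (x ∷ xs) f = cong (f (h x) +_) (Σl-map h xs f)

  Σl-exceptOne-map : ∀ {A B : Set} (f : A → B) (xs : List A) (r : Fin (length xs)) {g : A → Carrier} {h : B → Carrier} →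
                     (∀ {x} → x ∈ exceptOne xs r → g x ≈ h (f x)) →
                     Σl (exceptOne xs r) g ≈ Σl (exceptOne (map f xs) (mapIndex f xs r)) h
  Σl-exceptOne-map f xs r {g} {h} g≈hf = begin
    Σl (exceptOne xs r) g                             ≈⟨ Σl-cong (exceptOne xs r) g≈hf ⟩
    Σl (exceptOne xs r) (h ∘ f)                       ≡⟨ Σl-map f (exceptOne xs r) h ⟨
    Σl (map f (exceptOne xs r)) h                     ≡⟨ cong (λ ys → Σl ys h) (exceptOne-map f xs r) ⟩
    Σl (exceptOne (map f xs) (mapIndex f xs r)) h     ∎

  Σl-joined : ∀ {n} {P Q R : List (Fin n)} {i j : Fin n} → Joined P i Q j R →
              (f : Fin n → Carrier) → Σl R f ≈ Σl P f + Σl Q f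
  Σl-joined (P' , Q' , P'~P , Q'~Q , _ , _ , refl) f = ≈-trans (Σl-++ P' Q' f) (+-cong (reoriented P'~P) (reoriented Q'~Q))
    where
      reoriented : ∀ {X X'} → Reorientation X' X → Σl X' f ≈ Σl X f
      reoriented     (inj₁ refl) = ≈-refl
      reoriented {X} (inj₂ refl) = Σl-reverse X f

  module _ {n : ℕ} (D : Subset n → Subset n → Carrier) (A B : Subset n) (α : Carrier) where

    updateD-mergedˡ : ∀ Y → Y ≢ A ∪ B → updateD D A B α (A ∪ B) Y ≡ α * D A Y + (1# - α) * D B Y
    updateD-mergedˡ Y Y≢X with (A ∪ B) ≟ˢ (A ∪ B) | Y ≟ˢ (A ∪ B)
    ... | yes _   | no _     = refl
    ... | yes _   | yes Y≡X = ⊥-elim (Y≢X Y≡X)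
    ... | no X≢X  | _        = ⊥-elim (X≢X refl)

    updateD-mergedʳ : ∀ Y → Y ≢ A ∪ B → updateD D A B α Y (A ∪ B) ≡ α * D A Y + (1# - α) * D B Y
    updateD-mergedʳ Y Y≢X with Y ≟ˢ (A ∪ B) | (A ∪ B) ≟ˢ (A ∪ B)
    ... | no _     | yes _  = refl
    ... | yes Y≡X | _      = ⊥-elim (Y≢X Y≡X)
    ... | no _     | no X≢X = ⊥-elim (X≢X refl)

    updateD-other : ∀ Y Y' → Y ≢ A ∪ B → Y' ≢ A ∪ B → updateD D A B α Y Y' ≡ D Y Y'
    updateD-other Y Y' Y≢X Y'≢X with Y ≟ˢ (A ∪ B) | Y' ≟ˢ (A ∪ B)
    ... | no _     | no _      = refl
    ... | yes Y≡X | _         = ⊥-elim (Y≢X Y≡X)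
    ... | no _     | yes Y'≡X = ⊥-elim (Y'≢X Y'≡X)

  module _ {n : ℕ} (δ : Fin n → Fin n → Carrier) where

    nnRun-length : ∀ {L : Set c} {Adj : L → Weight δ → Weight δ → Block δ → Block δ → Set (ℓ₁ ⊔ ℓ₂)} {bs μ ms} →
                   NNRun δ Adj bs μ ms → length ms ≡ length bs ∸ 1
    nnRun-length done = refl
    nnRun-length {bs = bs} (step r s _ _ _ _ _ r≢s _ _ _ _ _ _ run) =
      trans (cong suc (nnRun-length run)) (length-exceptTwo bs r s r≢s)

    nnRun-isBinaryTree : ∀ {L : Set c} {Adj : L → Weight δ → Weight δ → Block δ → Block δ → Set (ℓ₁ ⊔ ℓ₂)} {bs μ ms} →
                         NNRun δ Adj bs μ ms → IsPartition bs → ∀ {H} → IsForestOver bs H →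
                         IsBinaryTreeClusters n (H ++ map (mergedCluster δ) ms)
    nnRun-isBinaryTree done part {H} forest =
      subst (IsBinaryTreeClusters n) (sym (List.++-identityʳ H)) (singleBlock-isBinaryTree part forest)
    nnRun-isBinaryTree (step r s _ _ _ _ _ r≢s _ _ J _ _ _ run) part {H} forest =
      subst (IsBinaryTreeClusters n) (List.++-assoc H _ _)
            (nnRun-isBinaryTree run (Merging.merge-isPartition part r≢s J) (ForestMerging.merge-isForestOver part r≢s J forest))

    δB-as-δx : ∀ μ (P Q : List (Fin n)) → δB δ μ P Q ≈ Σl P (λ i → μ i * δx δ μ i Q)
    δB-as-δx μ P Q = Σl-cong P λ {i} _ →
      ≈-trans (Σl-cong Q λ {j} _ → *-assoc (μ i) (μ j) (δ i j)) (Σl-*ˡ Q (μ i) _)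

    δB-sym : (∀ i j → δ i j ≈ δ j i) → ∀ μ (P Q : List (Fin n)) → δB δ μ P Q ≈ δB δ μ Q P
    δB-sym δ-sym μ P Q = ≈-trans (Σl-swap P Q (λ i j → μ i * μ j * δ i j))
      (Σl-cong Q λ {j} _ → Σl-cong P λ {i} _ → *-cong (*-comm (μ i) (μ j)) (δ-sym i j))

    AgreesOnBlocks : List (List (Fin n)) → Weight δ → (Subset n → Subset n → Carrier) → Set ℓ₁
    AgreesOnBlocks bs μ D = ∀ {C C'} → C ∈ bs → C' ∈ bs → C ≢ C' → δB δ μ C C' ≈ D (toSubset C) (toSubset C')

    module TreeWeightedMerging (δ-sym : ∀ i j → δ i j ≈ δ j i)
                               {bs : List (List (Fin n))} (part : IsPartition bs)
                               {r s : Fin (length bs)} (r≢s : r ≢ s)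
                               {i j : Fin n} {R : List (Fin n)} (J : Joined (lookup bs r) i (lookup bs s) j R)
                               {μ μ' : Weight δ} {α : Carrier} (tree : TreeAdj δ α μ μ' (lookup bs r) (lookup bs s))
                               (μ'≈μ-outside : ∀ k → k ∉ R → μ' k ≈ μ k)
                               {D : Subset n → Subset n → Carrier} (agrees : AgreesOnBlocks bs μ D) where

      open IsPartition part
      open Merging part r≢s J

      A B : Subset n
      A = toSubset Cr
      B = toSubset Cs

      μ'≈μ-on-rest : ∀ {C k} → C ∈ rest → k ∈ C → μ' k ≈ μ k
      μ'≈μ-on-rest C∈ k∈C = μ'≈μ-outside _ (rest-disjoint-joined C∈ k∈C)

      Σl-treeWeighted : ∀ (h : Fin n → Carrier) →
        Σl R (λ i → μ' i * h i) ≈ α * Σl Cr (λ i → μ i * h i) + (1# - α) * Σl Cs (λ i → μ i * h i)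
      Σl-treeWeighted h = ≈-trans (Σl-joined J (λ i → μ' i * h i))
                                  (+-cong (scaled α Cr (proj₁ (proj₂ tree))) (scaled (1# - α) Cs (proj₂ (proj₂ tree))))
        where
          scaled : ∀ a C → (∀ i → i ∈ C → μ' i ≈ a * μ i) → Σl C (λ i → μ' i * h i) ≈ a * Σl C (λ i → μ i * h i)
          scaled a C μ'≈aμ = ≈-trans (Σl-cong C λ {i} i∈ → ≈-trans (*-cong (μ'≈aμ i i∈) ≈-refl) (*-assoc a (μ i) (h i)))
                                     (Σl-*ˡ C a _)

      δB-joined : ∀ {C} → C ∈ rest → δB δ μ' R C ≈ α * D A (toSubset C) + (1# - α) * D B (toSubset C)
      δB-joined {C} C∈ = let C∈bs , C≢Cr , C≢Cs = ∈-rest⁻ C∈ in begin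
        δB δ μ' R C
          ≈⟨ δB-as-δx μ' R C ⟩
        Σl R (λ i → μ' i * δx δ μ' i C)
          ≈⟨ Σl-cong R (λ _ → *-cong ≈-refl (Σl-cong C λ k∈ → *-cong (μ'≈μ-on-rest C∈ k∈) ≈-refl)) ⟩
        Σl R (λ i → μ' i * δx δ μ i C)
          ≈⟨ Σl-treeWeighted (λ i → δx δ μ i C) ⟩
        α * Σl Cr (λ i → μ i * δx δ μ i C) + (1# - α) * Σl Cs (λ i → μ i * δx δ μ i C)
          ≈⟨ +-cong (*-cong ≈-refl (δB-as-δx μ Cr C)) (*-cong ≈-refl (δB-as-δx μ Cs C)) ⟨
        α * δB δ μ Cr C + (1# - α) * δB δ μ Cs C
          ≈⟨ +-cong (*-cong ≈-refl (agrees Cr∈ C∈bs (C≢Cr ∘ sym))) (*-cong ≈-refl (agrees Cs∈ C∈bs (C≢Cs ∘ sym))) ⟩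
        α * D A (toSubset C) + (1# - α) * D B (toSubset C)
          ∎

      toSubset-rest≢merged : ∀ {C} → C ∈ rest → toSubset C ≢ A ∪ B
      toSubset-rest≢merged {C} C∈ C≡X = let k , k∈C = nonempty (proj₁ (∈-rest⁻ C∈)) in
        rest-disjoint-joined C∈ k∈C (∈-toSubset⁻ R (subst (k ∈ₛ_) (trans C≡X (sym (toSubset-joined J))) (∈-toSubset⁺ C k∈C)))

      merge-agreesOnBlocks : AgreesOnBlocks (R ∷ rest) μ' (updateD D A B α)
      merge-agreesOnBlocks (here refl) (here refl) R≢R = ⊥-elim (R≢R refl)
      merge-agreesOnBlocks {C' = C'} (here refl) (there C'∈) _ = begin
        δB δ μ' R C'                                             ≈⟨ δB-joined C'∈ ⟩
        α * D A (toSubset C') + (1# - α) * D B (toSubset C')     ≡⟨ updateD-mergedˡ D A B α (toSubset C') (toSubset-rest≢merged C'∈) ⟨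
        updateD D A B α (A ∪ B) (toSubset C')                    ≡⟨ cong (λ X → updateD D A B α X (toSubset C')) (toSubset-joined J) ⟨
        updateD D A B α (toSubset R) (toSubset C')               ∎
      merge-agreesOnBlocks {C = C} (there C∈) (here refl) _ = begin
        δB δ μ' C R                                              ≈⟨ δB-sym δ-sym μ' C R ⟩
        δB δ μ' R C                                              ≈⟨ δB-joined C∈ ⟩
        α * D A (toSubset C) + (1# - α) * D B (toSubset C)       ≡⟨ updateD-mergedʳ D A B α (toSubset C) (toSubset-rest≢merged C∈) ⟨
        updateD D A B α (toSubset C) (A ∪ B)                     ≡⟨ cong (updateD D A B α (toSubset C)) (toSubset-joined J) ⟨
        updateD D A B α (toSubset C) (toSubset R)                ∎
      merge-agreesOnBlocks {C = C} {C'} (there C∈) (there C'∈) C≢C' = begin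
        δB δ μ' C C'
          ≈⟨ Σl-cong C (λ i∈ → Σl-cong C' λ j∈ → *-cong (*-cong (μ'≈μ-on-rest C∈ i∈) (μ'≈μ-on-rest C'∈ j∈)) ≈-refl) ⟩
        δB δ μ C C'                                ≈⟨ agrees (proj₁ (∈-rest⁻ C∈)) (proj₁ (∈-rest⁻ C'∈)) C≢C' ⟩
        D (toSubset C) (toSubset C')               ≡⟨ updateD-other D A B α _ _ (toSubset-rest≢merged C∈) (toSubset-rest≢merged C'∈) ⟨
        updateD D A B α (toSubset C) (toSubset C')  ∎

    module _ {bs : List (List (Fin n))} (part : IsPartition bs) {μ : Weight δ}
             {D : Subset n → Subset n → Carrier} (agrees : AgreesOnBlocks bs μ D) where

      open IsPartition part
      open IsTotalOrder isTotalOrder using (≤-respˡ-≈; ≤-respʳ-≈)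

      private
        clusterIndex : Fin (length bs) → Fin (length (map toSubset bs))
        clusterIndex = mapIndex toSubset bs

      qcrit-agrees : ∀ r s → r ≢ s → Qcrit (δB δ μ) bs r s ≈ Qcrit D (map toSubset bs) (clusterIndex r) (clusterIndex s)
      qcrit-agrees r s r≢s rewrite lookup-mapIndex toSubset bs r | lookup-mapIndex toSubset bs s =
        −-cong (−-cong (*-cong (reflexive (cong (λ m → nat (m ∸ 2)) (sym (length-map toSubset bs))))
                               (agrees (∈-lookup r) (∈-lookup s) (r≢s ∘ lookup-injective unique)))
                       (Σl-exceptOne-map toSubset bs r λ C∈ → let C∈bs , C≢Cr = ∈-exceptOne⇒other unique C∈ in
                          agrees (∈-lookup r) C∈bs (C≢Cr ∘ sym)))
               (Σl-exceptOne-map toSubset bs s λ C∈ → let C∈bs , C≢Cs = ∈-exceptOne⇒other unique C∈ in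
                  agrees C∈bs (∈-lookup s) C≢Cs)
        where
          −-cong : ∀ {a a' b b'} → a ≈ a' → b ≈ b' → a - b ≈ a' - b'
          −-cong a≈a' b≈b' = +-cong a≈a' (-‿cong b≈b')

      qMinimal-agrees : ∀ r s → r ≢ s → QMinimal (δB δ μ) bs r s → QMinimal D (map toSubset bs) (clusterIndex r) (clusterIndex s)
      qMinimal-agrees r s r≢s minimal a b a≢b =
        subst₂ (λ a b → Qcrit D (map toSubset bs) (clusterIndex r) (clusterIndex s) ≤ᴿ Qcrit D (map toSubset bs) a b)
               (mapIndex-surjective toSubset bs a) (mapIndex-surjective toSubset bs b)
               (≤-respʳ-≈ (qcrit-agrees a' b' a'≢b') (≤-respˡ-≈ (qcrit-agrees r s r≢s) (minimal a' b' a'≢b')))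
        where
          a' = cast (length-map toSubset bs) a
          b' = cast (length-map toSubset bs) b
          a'≢b' : a' ≢ b'
          a'≢b' a'≡b' = a≢b (trans (sym (mapIndex-surjective toSubset bs a))
                                     (trans (cong clusterIndex a'≡b') (mapIndex-surjective toSubset bs b)))

    initialWeight-agrees : ∀ {D} → (∀ i j → D ⁅ i ⁆ ⁅ j ⁆ ≈ δ i j) → AgreesOnBlocks (initialBlocks δ) (initialWeight δ) D
    initialWeight-agrees {D} D≈δ C∈ C'∈ _ with i , _ , refl ← ∈-map⁻ [_] C∈ with j , _ , refl ← ∈-map⁻ [_] C'∈ = begin
      δB δ (initialWeight δ) [ i ] [ j ]   ≈⟨ ≈-trans (+-identityʳ _) (+-identityʳ _) ⟩
      1# * 1# * δ i j                      ≈⟨ ≈-trans (*-cong (*-identityˡ 1#) ≈-refl) (*-identityˡ _) ⟩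
      δ i j                                ≈⟨ D≈δ i j ⟨
      D ⁅ i ⁆ ⁅ j ⁆                        ≡⟨ cong₂ D toSubset-[ i ] toSubset-[ j ] ⟨
      D (toSubset [ i ]) (toSubset [ j ])  ∎

    private
      njRun-step : ∀ {cs : List (Subset n)} {D rest} (r s : Fin (length cs)) (α : Carrier) → r ≢ s → QMinimal D cs r s →
                   ∀ {A B} → lookup cs r ≡ A → lookup cs s ≡ B →
                   NJRun ((A ∪ B) ∷ exceptTwo cs r s) (updateD D A B α) rest → NJRun cs D ((A , B , α) ∷ rest)
      njRun-step r s α r≢s minimal refl refl = step r s α r≢s minimal

    nnRun⇒njRun : (∀ i j → δ i j ≈ δ j i) → ∀ {bs μ ms} → NNRun δ (TreeAdj δ) bs μ ms → IsPartition bs →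
                  ∀ {D} → AgreesOnBlocks bs μ D → NJRun (map toSubset bs) D ms
    nnRun⇒njRun δ-sym done _ _ = done
    nnRun⇒njRun δ-sym {bs} {ms = _ ∷ ms} (step r s _ _ _ _ α r≢s minimal _ J tree μ'≈μ-outside _ run) part {D} agrees =
      njRun-step (mapIndex toSubset bs r) (mapIndex toSubset bs s) α (r≢s ∘ mapIndex-injective toSubset bs)
        (qMinimal-agrees part {D = D} agrees r s r≢s minimal) (lookup-mapIndex toSubset bs r) (lookup-mapIndex toSubset bs s)
        (subst (λ cs → NJRun cs (updateD D A B α) ms) (cong₂ _∷_ (toSubset-joined J) (exceptTwo-map toSubset bs r s r≢s))
               (nnRun⇒njRun δ-sym run merge-isPartition merge-agreesOnBlocks))
      where
        open Merging part r≢s J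
        open TreeWeightedMerging δ-sym part r≢s J tree μ'≈μ-outside {D} agrees

mainTheorem4 : ∀ {c ℓ₁ ℓ₂} (𝓡 : OrderedCommRing c ℓ₁ ℓ₂) (n : ℕ) → 3 ≤ n →
    (δ : Fin n → Fin n → OrderedCommRing.Carrier 𝓡) → NeighborNet.IsDissimilarity 𝓡 δ →
    -- (i) for any run of neighbor-net (any admissible adjustment steps),
    --     the recorded splits are pairwise compatible and correspond
    --     bijectively to the clusters of a binary tree T
    (∀ {L : Set c} (Adj : L → NeighborNet.Weight 𝓡 δ → NeighborNet.Weight 𝓡 δ → NeighborNet.Block 𝓡 δ → NeighborNet.Block 𝓡 δ → Set (ℓ₁ ⊔ ℓ₂))
       (ms : List (NeighborNet.Merge 𝓡 δ L)) →
       NeighborNet.NNRun 𝓡 δ Adj (NeighborNet.initialBlocks 𝓡 δ) (NeighborNet.initialWeight 𝓡 δ) ms →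
       PairwiseCompatible (map (NeighborNet.mergedCluster 𝓡 δ) ms)
       × length ms ≡ n ∸ 1
       × IsBinaryTreeClusters n (singletonSets n ++ map (NeighborNet.mergedCluster 𝓡 δ) ms))
    ×
    -- (ii) for any run using tree weightings with parameters α_k, the
    --      sequence of merges (C_r*, C_s*, α_k) is a run of neighbor
    --      joining with agglomeration parameter α_k at step k
    (∀ (ms : List (NeighborNet.Merge 𝓡 δ (OrderedCommRing.Carrier 𝓡))) →
       NeighborNet.NNRun 𝓡 δ (NeighborNet.TreeAdj 𝓡 δ) (NeighborNet.initialBlocks 𝓡 δ) (NeighborNet.initialWeight 𝓡 δ) ms →
       ∀ (D : Subset n → Subset n → OrderedCommRing.Carrier 𝓡) →
       (∀ i j → OrderedCommRing._≈_ 𝓡 (D ⁅ i ⁆ ⁅ j ⁆) (δ i j)) →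
       NeighborNet.NJRun 𝓡 (singletonSets n) D ms)
mainTheorem4 𝓡 n _ δ (δ-sym , _) =
  (λ Adj ms run →
     let tree@(_ , _ , _ , _ , laminar , _) =
           nnRun-isBinaryTree 𝓡 δ run singletonBlocks-isPartition singletonSets-isForestOver
     in laminar⇒pairwiseCompatible (λ U V U∈ V∈ → laminar U V (∈-++⁺ʳ _ U∈) (∈-++⁺ʳ _ V∈))
      , trans (nnRun-length 𝓡 δ run) (cong (_∸ 1) (length-singletonBlocks {n}))
      , tree)
  , λ ms run D D≈δ →
      subst (λ cs → NeighborNet.NJRun 𝓡 cs D ms) map-toSubset-singletonBlocks
            (nnRun⇒njRun 𝓡 δ δ-sym run singletonBlocks-isPartition (initialWeight-agrees 𝓡 δ {D} D≈δ))
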